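{- Consider the following procedure. Let $m=\lceil \log_2 T\rceil$ and initialize buckets $B_0=\dots=B_m=\emptyset$. For each update $t=1,\dots,T$: (1) rewind the incremental algorithm's computation to the state obtained by inserting $B_m, B_{m-1},\dots,B_{k(t)+2}$ (in that order, as left by previous steps); (2) add the inserted element to $B_0$, or remove the deleted element from $B_0$; (3) let $B = B_0\cup\dots\cup B_{k(t)+1}$, set $B_i$ to be the set of the $2^i$-th through $(2^{i+1}-1)$-th youngest elements of $B$ for each $i\in[0:k(t)]$, and set $B_{k(t)+1} = B\setminus(B_0\cup\dots\cup B_{k(t)})$; (4) call Insert on the elements of $B_{k(t)+1}, B_{k(t)},\dots,B_0$ in this order (in reverse order of deletion). Then for every $t\in[T]$, at the end of the $t$-th update: (i) $|B_0\cup\dots\cup B_{k(t)+1}| \leq 2^{k(t)+2}+2^{k(t)}$; (ii) $E_{t,2^{i+1}-1} \subseteq B_0\cup\dots\cup B_i$ for every $i\in[0:k(t)]$.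
   Context: Setting: a sequence of $T$ updates (insertions and deletions of elements) in the deletions-look-ahead model, i.e. the relative order in which current elements will be deleted is known. An element $e_1$ is younger than $e_2$ if $e_1$ will be deleted earlier than $e_2$; the rank-$r$ element is the $r$-th youngest current element; for an ordered set $A$, $A[n_1:n_2]$ is the set of its $n_1$-th to $n_2$-th youngest elements. $[n_1:n_2]=\{n_1,\dots,n_2\}$. For $t\in[T]$, $k(t)$ is the largest integer such that $t$ is a multiple of $2^{k(t)}$. $E_t$ denotes the set of all existing elements at the end of the $t$-th update and $E_{t,r}$ the youngest $r$ elements of $E_t$ (or all of $E_t$ if $|E_t|<r$). -}

module Defs where

open import Data.Nat using (ℕ; zero; suc; _+_; _∸_; _^_; _≤_; _≤ᵇ_; _≟_)
open import Data.Nat.Properties using (≤-decTotalOrder)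
open import Data.Nat.DivMod using (_%_; _/_)
open import Data.List using (List; []; _∷_; filter; take; drop; concat; map; upTo; deduplicate; length)
open import Data.List.Membership.Propositional using (_∈_; _∉_)
open import Data.Bool using (Bool; true; false; if_then_else_)
open import Data.Product using (_×_)
open import Data.Unit using (⊤)
open import Relation.Nullary using (¬?)
open import Data.List.Sort.InsertionSort ≤-decTotalOrder using (sort)

-- Elements are natural numbers; the key encodes the (known) deletion order:
-- a smaller key means the element will be deleted earlier, i.e. is YOUNGER.
-- So the r-th youngest elements of a set are the first r of its ascending sort.

data Update : Set where
  ins : ℕ → Update
  del : ℕ → Update

youngest : ℕ → List ℕ → List ℕ
youngest r A = take r (sort (deduplicate _≟_ A))

applyE : Update → List ℕ → List ℕ
applyE (ins e) E = e ∷ E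
applyE (del e) E = filter (λ x → ¬? (x ≟ e)) E

Valid : List ℕ → List Update → Set
Valid E [] = ⊤
Valid E (ins e ∷ us) = (e ∉ E) × Valid (e ∷ E) us
Valid E (del e ∷ us) = (e ∈ E) × ((x : ℕ) → x ∈ E → e ≤ x) × Valid (applyE (del e) E) us

-- 2-adic valuation k(t) (fuel-bounded; fuel t suffices)
val2 : ℕ → ℕ → ℕ
val2 zero n = 0
val2 (suc f) zero = 0
val2 (suc f) (suc n) with (suc n) % 2
... | zero = suc (val2 f (suc n / 2))
... | suc _ = 0

kk : ℕ → ℕ
kk t = val2 t t

unionUpTo : (ℕ → List ℕ) → ℕ → List ℕ
unionUpTo B n = concat (map B (upTo n))

record State : Set where
  field
    buckets : ℕ → List ℕ   -- B_0, B_1, ... (all buckets beyond those used stay empty)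
    elems   : List ℕ

open State public

initState : State
initState = record { buckets = λ _ → [] ; elems = [] }

updB0 : Update → List ℕ → List ℕ
updB0 (ins e) B0 = e ∷ B0
updB0 (del e) B0 = filter (λ x → ¬? (x ≟ e)) B0

-- the t-th update (t ≥ 1): steps (2)-(3) of the procedure
-- (step (1) and (4) only concern the incremental algorithm, not the buckets)
step : ℕ → Update → State → State
step t u s = record { buckets = newB ; elems = applyE u (elems s) }
  where
    k : ℕ
    k = kk t
    B' : ℕ → List ℕ
    B' zero = updB0 u (buckets s zero)
    B' (suc i) = buckets s (suc i)
    Bs : List ℕ
    Bs = sort (deduplicate _≟_ (unionUpTo B' (suc (suc k))))
    newB : ℕ → List ℕ
    newB i = if i ≤ᵇ k then take (2 ^ i) (drop (2 ^ i ∸ 1) Bs)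
             else (if i ≤ᵇ suc k then drop (2 ^ suc k ∸ 1) Bs else B' i)

run : ℕ → State → List Update → State
run t s [] = s
run t s (u ∷ us) = run (suc t) (step t u s) us

stateAt : List Update → ℕ → State
stateAt us t = run 1 initState (take t us)

-- Call t mod 2^m the slack of level m after update t. The invariant is that the first m+1
-- buckets hold at most 2^(m+1) − 1 + slack elements, and that every element of a later bucket
-- is older than at least 2^(m+1) − 1 − slack distinct elements of them. Changing B_0 costs one
-- unit of slack at every level (a deleted element, being the youngest, can only lie in B_0).
-- Rebuilding B_0, …, B_(k+1), k = k(t), from their merge sorted by age makes the first m+1
-- buckets, m ≤ k, exactly the 2^(m+1) − 1 youngest elements of the merge, so the slack 0 of
-- these levels is met: those elements are also younger than everything above level k+1,
-- because the slack 2^k at level k+1 still leaves each such element 2^(k+1) − 1 younger ones in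
-- the merge. Levels above k are untouched, and there t mod 2^m = (t − 1) mod 2^m + 1.
-- Part (i) is the size bound at level k+1, part (ii) the rank bound at the levels m ≤ k.

module Submission where

open import Defs
open import Relation.Binary.PropositionalEquality using (_≡_; _≢_; refl; sym; trans; cong; cong₂; subst; subst₂; setoid; module ≡-Reasoning)
open import Data.Nat using (ℕ; zero; suc; _+_; _*_; _^_; _≤_; _<_; _∸_; _≟_; _≤ᵇ_; _<?_; _≤?_; _⊔_; z≤n; s≤s; s≤s⁻¹; NonZero)
open import Data.Nat.Properties
open import Data.Nat.DivMod using (_%_; _/_; m≡m%n+[m/n]*n; [m+kn]%n≡m%n; m%n<n; m<n⇒m%n≡m; n%n≡0; n%1≡0)
open import Data.Nat.Divisibility using (_∣_; n∣m⇒m%n≡0; m%n≡0⇒n∣m; ∣-trans; ∣m∣n⇒∣m+n; ∣m+n∣m⇒∣n; ∣n⇒∣m*n; *-monoʳ-∣; 1∣_; ∣⇒≤)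
open import Data.Nat.Tactic.RingSolver using (solve-∀)
open import Data.Bool using (true; false; if_then_else_)
open import Data.List using (List; []; _∷_; _++_; [_]; length; filter; take; drop; concat; map; upTo; deduplicate)
open import Data.List.Properties using (map-++; concat-++; ++-identityʳ; length-++; upTo-∷ʳ; map-applyUpTo; map-cong; length-take; length-deduplicate; length-filter; filter-notAll; filter-accept; filter-reject; filter-none; take++drop≡id; drop-drop)
open import Data.List.Membership.Propositional using (_∈_; _∉_)
open import Data.List.Membership.Propositional.Properties using (∈-++⁺ˡ; ∈-++⁺ʳ; ∈-++⁻; ∈-filter⁺; ∈-filter⁻; ∈-deduplicate⁺; ∈-deduplicate⁻)
open import Data.List.Relation.Binary.Subset.Propositional using (_⊆_)
open import Data.List.Relation.Unary.Any using (Any; here; there)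
open import Data.List.Relation.Unary.All as All using (All; []; _∷_)
open import Data.List.Relation.Unary.AllPairs as AllPairs using (AllPairs; []; _∷_)
open import Data.List.Relation.Unary.Linked.Properties using (Linked⇒AllPairs)
open import Data.List.Relation.Unary.Unique.Propositional using (Unique)
import Data.List.Relation.Unary.Unique.Propositional.Properties as Unique
open import Data.List.Relation.Unary.Unique.DecPropositional.Properties _≟_ using (deduplicate-!)
open import Data.List.Relation.Binary.Permutation.Propositional using (↭-sym; ↭⇒↭ₛ)
open import Data.List.Relation.Binary.Permutation.Propositional.Properties using (∈-resp-↭; ↭-length)
open import Data.List.Relation.Binary.Permutation.Setoid.Properties (setoid ℕ) using (Unique-resp-↭)
import Data.List.Relation.Binary.Sublist.Propositional as Sublist
open import Data.List.Relation.Binary.Sublist.Propositional.Properties using (take-⊆; drop-⊆)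
open import Data.List.Sort.InsertionSort ≤-decTotalOrder using (sort)
open import Data.List.Sort.InsertionSort.Properties ≤-decTotalOrder using (sort-↭; sort-↗)
open import Data.Product using (Σ-syntax; ∃-syntax; _×_; _,_; proj₁; proj₂)
open import Data.Sum using (_⊎_; inj₁; inj₂)
open import Data.Unit using (⊤; tt)
open import Data.Empty using (⊥-elim)
open import Function using (_∘_)
open import Relation.Nullary using (¬_; yes; no; ¬?)

unionUpTo-suc : ∀ f n → unionUpTo f (suc n) ≡ unionUpTo f n ++ f n
unionUpTo-suc f n = begin
  concat (map f (upTo (suc n)))          ≡⟨ cong (concat ∘ map f) (sym (upTo-∷ʳ n)) ⟩
  concat (map f (upTo n ++ [ n ]))       ≡⟨ cong concat (map-++ f (upTo n) [ n ]) ⟩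
  concat (map f (upTo n) ++ [ f n ])     ≡⟨ sym (concat-++ (map f (upTo n)) [ f n ]) ⟩
  unionUpTo f n ++ (f n ++ [])           ≡⟨ cong (unionUpTo f n ++_) (++-identityʳ (f n)) ⟩
  unionUpTo f n ++ f n                   ∎
  where open ≡-Reasoning

unionUpTo-suc-head : ∀ f n → unionUpTo f (suc n) ≡ f 0 ++ unionUpTo (f ∘ suc) n
unionUpTo-suc-head f n = cong (λ xs → f 0 ++ concat xs)
  (trans (map-applyUpTo suc f n) (sym (map-applyUpTo (λ i → i) (f ∘ suc) n)))

unionUpTo-cong : ∀ {f g} → (∀ i → f i ≡ g i) → ∀ n → unionUpTo f n ≡ unionUpTo g n
unionUpTo-cong f≗g n = cong concat (map-cong f≗g (upTo n))

length-unionUpTo-suc : ∀ f n → length (unionUpTo f (suc n)) ≡ length (unionUpTo f n) + length (f n)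
length-unionUpTo-suc f n = trans (cong length (unionUpTo-suc f n)) (length-++ (unionUpTo f n))

length-unionUpTo-suc-head : ∀ f n → length (unionUpTo f (suc n)) ≡ length (f 0) + length (unionUpTo (f ∘ suc) n)
length-unionUpTo-suc-head f n = trans (cong length (unionUpTo-suc-head f n)) (length-++ (f 0))

∈-unionUpTo⁺ : ∀ f {n x} i → i < n → x ∈ f i → x ∈ unionUpTo f n
∈-unionUpTo⁺ f {suc n} {x} i i<1+n x∈ = subst (x ∈_) (sym (unionUpTo-suc f n)) (go (m<1+n⇒m<n∨m≡n i<1+n))
  where
  go : i < n ⊎ i ≡ n → x ∈ unionUpTo f n ++ f n
  go (inj₁ i<n)  = ∈-++⁺ˡ (∈-unionUpTo⁺ f i i<n x∈)
  go (inj₂ refl) = ∈-++⁺ʳ (unionUpTo f n) x∈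

∈-unionUpTo⁻ : ∀ f n {x} → x ∈ unionUpTo f n → ∃[ i ] i < n × x ∈ f i
∈-unionUpTo⁻ f (suc n) {x} x∈ with ∈-++⁻ (unionUpTo f n) (subst (x ∈_) (unionUpTo-suc f n) x∈)
... | inj₁ x∈′ = let (i , i<n , x∈fi) = ∈-unionUpTo⁻ f n x∈′ in i , m≤n⇒m≤1+n i<n , x∈fi
... | inj₂ x∈fn = n , ≤-refl , x∈fn

unionUpTo-[] : ∀ n → unionUpTo (λ _ → []) n ≡ []
unionUpTo-[] zero    = refl
unionUpTo-[] (suc n) = trans (unionUpTo-suc (λ _ → []) n) (trans (++-identityʳ _) (unionUpTo-[] n))

take++take-drop : ∀ a b (xs : List ℕ) → take a xs ++ take b (drop a xs) ≡ take (a + b) xs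
take++take-drop zero    b xs       = refl
take++take-drop (suc a) zero    [] = refl
take++take-drop (suc a) (suc b) [] = refl
take++take-drop (suc a) b (x ∷ xs) = cong (x ∷_) (take++take-drop a b xs)

∈-drop⇒<length : ∀ r (xs : List ℕ) {x} → x ∈ drop r xs → r < length xs
∈-drop⇒<length zero    (_ ∷ _)  _  = s≤s z≤n
∈-drop⇒<length (suc r) (_ ∷ xs) x∈ = s≤s (∈-drop⇒<length r xs x∈)

∈-drop-anti : ∀ {a b} (xs : List ℕ) {x} → a ≤ b → x ∈ drop b xs → x ∈ drop a xs
∈-drop-anti {a} {b} xs {x} a≤b x∈ = Sublist.lookup (drop-⊆ (b ∸ a) (drop a xs)) x∈′
  where
  x∈′ : x ∈ drop (b ∸ a) (drop a xs)
  x∈′ rewrite drop-drop a (b ∸ a) xs | m+[n∸m]≡n a≤b = x∈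

Unique⇒length≤ : ∀ {xs ys : List ℕ} → Unique xs → xs ⊆ ys → length xs ≤ length ys
Unique⇒length≤ {[]} _ _ = z≤n
Unique⇒length≤ {x ∷ xs} {ys} (x∉xs ∷ xs!) x∷xs⊆ys =
  ≤-trans (s≤s (Unique⇒length≤ xs! xs⊆ys-x)) (filter-notAll ≢x? ys (x∈⇒Any (x∷xs⊆ys (here refl))))
  where
  ≢x? = λ z → ¬? (z ≟ x)
  xs⊆ys-x : xs ⊆ filter ≢x? ys
  xs⊆ys-x z∈ = ∈-filter⁺ ≢x? (x∷xs⊆ys (there z∈)) (λ z≡x → All.lookup x∉xs z∈ (sym z≡x))
  x∈⇒Any : ∀ {zs} → x ∈ zs → Any (λ z → ¬ ¬ (z ≡ x)) zs
  x∈⇒Any (here z≡x) = here (λ z≢x → z≢x (sym z≡x))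
  x∈⇒Any (there x∈) = there (x∈⇒Any x∈)

sortDedup : List ℕ → List ℕ
sortDedup A = sort (deduplicate _≟_ A)

∈-sortDedup⁺ : ∀ {A x} → x ∈ A → x ∈ sortDedup A
∈-sortDedup⁺ {A} x∈ = ∈-resp-↭ (↭-sym (sort-↭ (deduplicate _≟_ A))) (∈-deduplicate⁺ _≟_ x∈)

∈-sortDedup⁻ : ∀ A {x} → x ∈ sortDedup A → x ∈ A
∈-sortDedup⁻ A x∈ = ∈-deduplicate⁻ _≟_ A (∈-resp-↭ (sort-↭ (deduplicate _≟_ A)) x∈)

length-sortDedup : ∀ A → length (sortDedup A) ≤ length A
length-sortDedup A = ≤-trans (≤-reflexive (↭-length (sort-↭ (deduplicate _≟_ A)))) (length-deduplicate _≟_ A)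

sortDedup-unique : ∀ A → Unique (sortDedup A)
sortDedup-unique A = Unique-resp-↭ (↭⇒↭ₛ (↭-sym (sort-↭ (deduplicate _≟_ A)))) (deduplicate-! A)

sortDedup-strict : ∀ A → AllPairs _<_ (sortDedup A)
sortDedup-strict A = AllPairs.zipWith (λ (x≤y , x≢y) → ≤∧≢⇒< x≤y x≢y)
  (Linked⇒AllPairs ≤-trans (sort-↗ (deduplicate _≟_ A)) , sortDedup-unique A)

take<drop : ∀ {S : List ℕ} r {x y} → AllPairs _<_ S → x ∈ take r S → y ∈ drop r S → x < y
take<drop {s ∷ S} (suc r) (s<S ∷ _)  (here refl) y∈ = All.lookup s<S (Sublist.lookup (drop-⊆ r S) y∈)
take<drop {s ∷ S} (suc r) (_ ∷ S<)   (there x∈)  y∈ = take<drop r S< x∈ y∈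

length-filter<-take : ∀ {S : List ℕ} r {x} → AllPairs _<_ S → x ∈ take r S → length (filter (_<? x) S) < r
length-filter<-take {s ∷ S} (suc r) (s<S ∷ _) (here refl)
  rewrite filter-reject (_<? s) {s} {S} (<-irrefl refl)
        | filter-none (_<? s) (All.map <⇒≯ s<S) = s≤s z≤n
length-filter<-take {s ∷ S} (suc r) {x} (_ ∷ S<) (there x∈) with s <? x
... | yes s<x rewrite filter-accept (_<? x) {s} {S} s<x = s≤s (length-filter<-take r S< x∈)
... | no s≮x  rewrite filter-reject (_<? x) {s} {S} s≮x = m<n⇒m<1+n (length-filter<-take r S< x∈)

record Younger (y : ℕ) (A : List ℕ) : Set where
  field
    members  : List ℕ
    distinct : Unique members
    ⊆A       : members ⊆ A
    all<     : All (_< y) members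

open Younger

size : ∀ {y A} → Younger y A → ℕ
size W = length (members W)

Younger-⊆ : ∀ {y A A′} → A ⊆ A′ → Younger y A → Younger y A′
Younger-⊆ A⊆A′ W = record { members = members W ; distinct = distinct W ; ⊆A = A⊆A′ ∘ ⊆A W ; all< = all< W }

Younger-≤ : ∀ {y z A} → y ≤ z → Younger y A → Younger z A
Younger-≤ y≤z W = record
  { members = members W ; distinct = distinct W ; ⊆A = ⊆A W
  ; all< = All.map (λ x<y → <-≤-trans x<y y≤z) (all< W) }

Younger-without : ∀ e {y A A′} → (∀ {x} → x ∈ A → x ≢ e → x ∈ A′) →
  (W : Younger y A) → Σ[ W′ ∈ Younger y A′ ] size W ≤ suc (size W′)
Younger-without e {A′ = A′} keep W = W′ , Unique⇒length≤ (distinct W) members⊆e∷rest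
  where
  ≢e? = λ x → ¬? (x ≟ e)
  rest = filter ≢e? (members W)
  W′ : Younger _ A′
  W′ = record
    { members  = rest
    ; distinct = Unique.filter⁺ ≢e? (distinct W)
    ; ⊆A       = λ x∈ → let (x∈W , x≢e) = ∈-filter⁻ ≢e? x∈ in keep (⊆A W x∈W) x≢e
    ; all<     = All.tabulate (λ x∈ → All.lookup (all< W) (proj₁ (∈-filter⁻ ≢e? x∈)))
    }
  members⊆e∷rest : members W ⊆ e ∷ rest
  members⊆e∷rest {x} x∈ with x ≟ e
  ... | yes x≡e = here x≡e
  ... | no x≢e  = there (∈-filter⁺ ≢e? x∈ x≢e)

Younger-witness : ∀ {y A} (W : Younger y A) → 0 < size W → ∃[ x ] x ∈ A × x < y
Younger-witness record { members = x ∷ _ ; ⊆A = ⊆A ; all< = x<y ∷ _ } _ = x , ⊆A (here refl) , x<y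

take-Younger : ∀ {S y} r → Unique S → r ≤ length S → (∀ {x} → x ∈ take r S → x < y) →
  Σ[ W ∈ Younger y (take r S) ] size W ≡ r
take-Younger {S} r S! r≤|S| all<y =
  record { members = take r S ; distinct = Unique.take⁺ r S! ; ⊆A = λ x∈ → x∈ ; all< = All.tabulate all<y } ,
  trans (length-take r S) (m≤n⇒m⊓n≡m r≤|S|)

Younger-size<youngest : ∀ {A r x} → x ∈ youngest r A → (W : Younger x A) → size W < r
Younger-size<youngest {A} {r} {x} x∈ W = ≤-<-trans
  (Unique⇒length≤ (distinct W) (λ z∈ → ∈-filter⁺ (_<? x) (∈-sortDedup⁺ (⊆A W z∈)) (All.lookup (all< W) z∈)))
  (length-filter<-take r (sortDedup-strict A) x∈)

_%2^_ : ℕ → ℕ → ℕ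
t %2^ m = (t % 2 ^ m) {{m^n≢0 2 m}}

2^-∣-mono : ∀ {a b} → a ≤ b → 2 ^ a ∣ 2 ^ b
2^-∣-mono {zero} {b} z≤n = 1∣ (2 ^ b)
2^-∣-mono (s≤s a≤b)      = *-monoʳ-∣ 2 (2^-∣-mono a≤b)

2^<2^suc : ∀ k → 2 ^ k < 2 ^ suc k
2^<2^suc k = ^-monoʳ-< 2 (s≤s (s≤s z≤n)) (n<1+n k)

2^n∸1+2^n≡2^[1+n]∸1 : ∀ n → (2 ^ n ∸ 1) + 2 ^ n ≡ 2 ^ suc n ∸ 1
2^n∸1+2^n≡2^[1+n]∸1 n = begin
  (2 ^ n ∸ 1) + 2 ^ n       ≡⟨ +-∸-comm (2 ^ n) (m^n>0 2 n) ⟨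
  (2 ^ n + 2 ^ n) ∸ 1       ≡⟨ cong (λ x → 2 ^ n + x ∸ 1) (+-identityʳ (2 ^ n)) ⟨
  2 ^ suc n ∸ 1             ∎
  where open ≡-Reasoning

2^[2+k]≤1+s+2^k⇒2^[1+k]∸1≤s : ∀ k s → 2 ^ suc (suc k) ≤ suc (s + 2 ^ k) → 2 ^ suc k ∸ 1 ≤ s
2^[2+k]≤1+s+2^k⇒2^[1+k]∸1≤s k s 2^[2+k]≤ = ∸-monoˡ-≤ 1 (+-cancelʳ-≤ (2 ^ suc k) (2 ^ suc k) (suc s) (begin
  2 ^ suc k + 2 ^ suc k          ≡⟨ cong (2 ^ suc k +_) (+-identityʳ (2 ^ suc k)) ⟨
  2 ^ suc (suc k)                ≤⟨ 2^[2+k]≤ ⟩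
  suc (s + 2 ^ k)                ≤⟨ s≤s (+-monoʳ-≤ s (<⇒≤ (2^<2^suc k))) ⟩
  suc s + 2 ^ suc k              ∎))
  where open ≤-Reasoning

val2-spec : ∀ fuel n → suc n ≤ fuel →
  ∃[ o ] suc n ≡ 2 ^ val2 fuel (suc n) + o * 2 ^ suc (val2 fuel (suc n))
val2-spec (suc fuel) n (s≤s n≤fuel) with suc n % 2 in eq | m≡m%n+[m/n]*n (suc n) 2 | m%n<n (suc n) 2
... | suc (suc _) | _ | s≤s (s≤s ())
... | suc zero | 1+n≡1+[n/2]*2 | _ = suc n / 2 , 1+n≡1+[n/2]*2
... | zero | 1+n≡[n/2]*2 | _ with suc n / 2
...   | zero = ⊥-elim (1+n≢0 1+n≡[n/2]*2)
...   | suc h with val2-spec fuel h (≤-trans (s≤s (m≤m*n h 2)) (subst (_≤ fuel) (suc-injective 1+n≡[n/2]*2) n≤fuel))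
...     | o , 1+h≡ = o , (begin
  suc n                                  ≡⟨ 1+n≡[n/2]*2 ⟩
  suc h * 2                              ≡⟨ cong (_* 2) 1+h≡ ⟩
  (2 ^ v + o * (2 * 2 ^ v)) * 2          ≡⟨ double (2 ^ v) o ⟩
  2 * 2 ^ v + o * (2 * (2 * 2 ^ v))      ∎)
  where
  open ≡-Reasoning
  v = val2 fuel (suc h)
  double : ∀ a o → (a + o * (2 * a)) * 2 ≡ 2 * a + o * (2 * (2 * a))
  double = solve-∀

kk-spec : ∀ n → ∃[ o ] suc n ≡ 2 ^ kk (suc n) + o * 2 ^ suc (kk (suc n))
kk-spec n = val2-spec (suc n) n ≤-refl

%2^≡0 : ∀ n m → m ≤ kk (suc n) → suc n %2^ m ≡ 0
%2^≡0 n m m≤k with kk-spec n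
... | o , 1+n≡ = n∣m⇒m%n≡0 (suc n) (2 ^ m) {{m^n≢0 2 m}}
  (subst (2 ^ m ∣_) (sym 1+n≡) (∣m∣n⇒∣m+n (2^-∣-mono m≤k) (∣n⇒∣m*n o (2^-∣-mono (m≤n⇒m≤1+n m≤k)))))

%2^≢0 : ∀ n m → kk (suc n) < m → suc n %2^ m ≢ 0
%2^≢0 n m k<m 1+n%2^m≡0 with kk-spec n
... | o , 1+n≡ = <⇒≱ (2^<2^suc k) (∣⇒≤ {{m^n≢0 2 k}} 2^[1+k]∣2^k)
  where
  k = kk (suc n)
  2^[1+k]∣1+n : 2 ^ suc k ∣ o * 2 ^ suc k + 2 ^ k
  2^[1+k]∣1+n = subst (2 ^ suc k ∣_) (trans 1+n≡ (+-comm (2 ^ k) _))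
    (∣-trans (2^-∣-mono k<m) (m%n≡0⇒n∣m (suc n) (2 ^ m) {{m^n≢0 2 m}} 1+n%2^m≡0))
  2^[1+k]∣2^k : 2 ^ suc k ∣ 2 ^ k
  2^[1+k]∣2^k = ∣m+n∣m⇒∣n 2^[1+k]∣1+n (∣n⇒∣m*n o (2^-∣-mono (≤-refl {suc k})))

%-suc : ∀ n d .{{_ : NonZero d}} → suc n % d ≢ 0 → suc n % d ≡ suc (n % d)
%-suc n d 1+n%d≢0 = by-cases (m≤n⇒m<n∨m≡n (m%n<n n d))
  where
  1+n%d≡[1+n%d]%d : suc n % d ≡ suc (n % d) % d
  1+n%d≡[1+n%d]%d = trans (cong (λ m → suc m % d) (m≡m%n+[m/n]*n n d)) ([m+kn]%n≡m%n (suc (n % d)) (n / d) d)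
  by-cases : suc (n % d) < d ⊎ suc (n % d) ≡ d → suc n % d ≡ suc (n % d)
  by-cases (inj₁ 1+n%d<d) = trans 1+n%d≡[1+n%d]%d (m<n⇒m%n≡m 1+n%d<d)
  by-cases (inj₂ 1+n%d≡d) = ⊥-elim (1+n%d≢0 (trans 1+n%d≡[1+n%d]%d (trans (cong (_% d) 1+n%d≡d) (n%n≡0 d))))

%2^-suc : ∀ n m → kk (suc n) < m → suc n %2^ m ≡ suc (n %2^ m)
%2^-suc n m k<m = %-suc n (2 ^ m) {{m^n≢0 2 m}} (%2^≢0 n m k<m)

%2^-suc-kk : ∀ n → suc n %2^ suc (kk (suc n)) ≡ 2 ^ kk (suc n)
%2^-suc-kk n with kk-spec n
... | o , 1+n≡ = trans (cong (λ t → (t % 2 ^ suc k) {{m^n≢0 2 (suc k)}}) 1+n≡)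
    (trans ([m+kn]%n≡m%n (2 ^ k) o (2 ^ suc k) {{m^n≢0 2 (suc k)}})
           (m<n⇒m%n≡m {{m^n≢0 2 (suc k)}} (2^<2^suc k)))
  where k = kk (suc n)

record Invariant (slack : ℕ → ℕ) (B : ℕ → List ℕ) (E : List ℕ) : Set where
  field
    cover⁺     : ∀ {x} → x ∈ E → ∃[ i ] x ∈ B i
    cover⁻     : ∀ {x} i → x ∈ B i → x ∈ E
    size-bound : ∀ m → suc (length (unionUpTo B (suc m))) ≤ 2 ^ suc m + slack m
    rank-bound : ∀ m {y} i → m < i → y ∈ B i →
                 Σ[ W ∈ Younger y (unionUpTo B (suc m)) ] 2 ^ suc m ≤ suc (size W + slack m)

module _ {c B E} (I : Invariant c B E) {f : ℕ → List ℕ} (f-suc : ∀ i → f (suc i) ≡ B (suc i)) where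
  open Invariant I

  Invariant-B₀-step : ∀ {E′} e →
    (∀ {x} → x ∈ E′ → ∃[ i ] x ∈ f i) →
    (∀ {x} i → x ∈ f i → x ∈ E′) →
    (∀ {x} i → x ∈ B i → x ≢ e → x ∈ f i) →
    length (f 0) ≤ suc (length (B 0)) →
    Invariant (suc ∘ c) f E′
  Invariant-B₀-step e cover⁺′ cover⁻′ keep |f₀|≤ = record
    { cover⁺ = cover⁺′ ; cover⁻ = cover⁻′ ; size-bound = size-bound′ ; rank-bound = rank-bound′ }
    where
    size-bound′ : ∀ m → suc (length (unionUpTo f (suc m))) ≤ 2 ^ suc m + suc (c m)
    size-bound′ m = begin
      suc (length (unionUpTo f (suc m)))                  ≡⟨ cong suc (length-unionUpTo-suc-head f m) ⟩
      suc (length (f 0) + length (unionUpTo (f ∘ suc) m)) ≡⟨ cong (λ A → suc (length (f 0) + length A)) (unionUpTo-cong f-suc m) ⟩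
      suc (length (f 0) + length (unionUpTo (B ∘ suc) m)) ≤⟨ s≤s (+-monoˡ-≤ _ |f₀|≤) ⟩
      suc (suc (length (B 0) + length (unionUpTo (B ∘ suc) m))) ≡⟨ cong (suc ∘ suc) (length-unionUpTo-suc-head B m) ⟨
      suc (suc (length (unionUpTo B (suc m))))            ≤⟨ s≤s (size-bound m) ⟩
      suc (2 ^ suc m + c m)                               ≡⟨ +-suc (2 ^ suc m) (c m) ⟨
      2 ^ suc m + suc (c m)                               ∎
      where open ≤-Reasoning
    keep-union : ∀ m {x} → x ∈ unionUpTo B (suc m) → x ≢ e → x ∈ unionUpTo f (suc m)
    keep-union m x∈ x≢e = let (j , j<1+m , x∈Bj) = ∈-unionUpTo⁻ B (suc m) x∈ in ∈-unionUpTo⁺ f j j<1+m (keep j x∈Bj x≢e)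
    rank-bound′ : ∀ m {y} i → m < i → y ∈ f i →
                  Σ[ W ∈ Younger y (unionUpTo f (suc m)) ] 2 ^ suc m ≤ suc (size W + suc (c m))
    rank-bound′ m (suc i) m<i y∈ with rank-bound m (suc i) m<i (subst (_ ∈_) (f-suc i) y∈)
    ... | W , bound with Younger-without e (keep-union m) W
    ...   | W′ , W≤1+W′ = W′ , ≤-trans bound (s≤s (≤-trans (+-monoˡ-≤ (c m) W≤1+W′) (≤-reflexive (sym (+-suc (size W′) (c m))))))

  Invariant-ins : ∀ e → f 0 ≡ e ∷ B 0 → Invariant (suc ∘ c) f (e ∷ E)
  Invariant-ins e f₀≡ = Invariant-B₀-step e cover⁺′ cover⁻′ (λ i x∈ _ → B⊆f i x∈) (≤-reflexive (cong length f₀≡))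
    where
    B⊆f : ∀ {x} i → x ∈ B i → x ∈ f i
    B⊆f zero    x∈ = subst (_ ∈_) (sym f₀≡) (there x∈)
    B⊆f (suc i) x∈ = subst (_ ∈_) (sym (f-suc i)) x∈
    cover⁺′ : ∀ {x} → x ∈ e ∷ E → ∃[ i ] x ∈ f i
    cover⁺′ (here refl) = 0 , subst (_ ∈_) (sym f₀≡) (here refl)
    cover⁺′ (there x∈)  = let (i , x∈Bi) = cover⁺ x∈ in i , B⊆f i x∈Bi
    cover⁻′ : ∀ {x} i → x ∈ f i → x ∈ e ∷ E
    cover⁻′ zero x∈ with subst (_ ∈_) f₀≡ x∈
    ... | here x≡e   = here x≡e
    ... | there x∈B₀ = there (cover⁻ 0 x∈B₀)
    cover⁻′ (suc i) x∈ = there (cover⁻ (suc i) (subst (_ ∈_) (f-suc i) x∈))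

  Invariant-del : ∀ e → c 0 ≡ 0 → (∀ x → x ∈ E → e ≤ x) → f 0 ≡ filter (λ x → ¬? (x ≟ e)) (B 0) →
    Invariant (suc ∘ c) f (filter (λ x → ¬? (x ≟ e)) E)
  Invariant-del e c₀≡0 e-min f₀≡ = Invariant-B₀-step e cover⁺′ cover⁻′ keep
    (≤-trans (≤-reflexive (cong length f₀≡)) (m≤n⇒m≤1+n (length-filter ≢e? (B 0))))
    where
    ≢e? = λ x → ¬? (x ≟ e)
    e∉upper : ∀ i → e ∉ B (suc i)
    e∉upper i e∈ with rank-bound 0 (suc i) (s≤s z≤n) e∈
    ... | W , bound
      with Younger-witness W (subst (1 ≤_) (+-identityʳ (size W)) (s≤s⁻¹ (subst (λ s → 2 ≤ suc (size W + s)) c₀≡0 bound)))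
    ...   | x , x∈B₀ , x<e with ∈-unionUpTo⁻ B 1 x∈B₀
    ...     | zero , _ , x∈ = <⇒≱ x<e (e-min x (cover⁻ 0 x∈))
    ...     | suc _ , s≤s () , _
    keep : ∀ {x} i → x ∈ B i → x ≢ e → x ∈ f i
    keep zero    x∈ x≢e = subst (_ ∈_) (sym f₀≡) (∈-filter⁺ ≢e? x∈ x≢e)
    keep (suc i) x∈ _   = subst (_ ∈_) (sym (f-suc i)) x∈
    cover⁺′ : ∀ {x} → x ∈ filter ≢e? E → ∃[ i ] x ∈ f i
    cover⁺′ x∈ = let (x∈E , x≢e) = ∈-filter⁻ ≢e? x∈ ; (i , x∈Bi) = cover⁺ x∈E in i , keep i x∈Bi x≢e
    cover⁻′ : ∀ {x} i → x ∈ f i → x ∈ filter ≢e? E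
    cover⁻′ zero x∈ = let (x∈B₀ , x≢e) = ∈-filter⁻ ≢e? (subst (_ ∈_) f₀≡ x∈) in ∈-filter⁺ ≢e? (cover⁻ 0 x∈B₀) x≢e
    cover⁻′ (suc i) x∈ = ∈-filter⁺ ≢e? (cover⁻ (suc i) x∈B) (λ { refl → e∉upper i x∈B })
      where x∈B = subst (_ ∈_) (f-suc i) x∈

merged : ℕ → (ℕ → List ℕ) → List ℕ
merged t f = sortDedup (unionUpTo f (suc (suc (kk t))))

rebalance : ℕ → (ℕ → List ℕ) → ℕ → List ℕ
rebalance t f i = if i ≤ᵇ kk t then take (2 ^ i) (drop (2 ^ i ∸ 1) (merged t f))
                  else (if i ≤ᵇ suc (kk t) then drop (2 ^ suc (kk t) ∸ 1) (merged t f) else f i)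

step-buckets : ∀ t u s → ∃[ f ] f 0 ≡ updB0 u (buckets s 0) × (∀ i → f (suc i) ≡ buckets s (suc i))
                                × buckets (step t u s) ≡ rebalance t f
step-buckets t u s = _ , refl , (λ _ → refl) , refl

module _ (t : ℕ) (f : ℕ → List ℕ) where
  private
    k = kk t
    M = merged t f
    R = rebalance t f

  rebalance-≤ : ∀ {i} → i ≤ k → R i ≡ take (2 ^ i) (drop (2 ^ i ∸ 1) M)
  rebalance-≤ {i} i≤k with i ≤ᵇ k | ≤⇒≤ᵇ i≤k
  ... | true | _ = refl

  rebalance-suc : R (suc k) ≡ drop (2 ^ suc k ∸ 1) M
  rebalance-suc with suc k ≤ᵇ k | ≤ᵇ⇒≤ (suc k) k
  ... | true  | 1+k≤k = ⊥-elim (<-irrefl refl (1+k≤k tt))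
  ... | false | _ with suc k ≤ᵇ suc k | ≤⇒≤ᵇ (≤-refl {suc k})
  ...   | true | _ = refl

  rebalance-> : ∀ {i} → suc k < i → R i ≡ f i
  rebalance-> {i} 1+k<i with i ≤ᵇ k | ≤ᵇ⇒≤ i k | i ≤ᵇ suc k | ≤ᵇ⇒≤ i (suc k)
  ... | true  | i≤k | _     | _      = ⊥-elim (<⇒≱ (<-trans (n<1+n k) 1+k<i) (i≤k tt))
  ... | false | _   | true  | i≤1+k  = ⊥-elim (<⇒≱ 1+k<i (i≤1+k tt))
  ... | false | _   | false | _      = refl

  unionUpTo-rebalance-≤ : ∀ {m} → m ≤ k → unionUpTo R (suc m) ≡ take (2 ^ suc m ∸ 1) M
  unionUpTo-rebalance-≤ {zero} _ = trans (unionUpTo-suc R 0) (rebalance-≤ z≤n)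
  unionUpTo-rebalance-≤ {suc m} 1+m≤k = begin
    unionUpTo R (suc (suc m))                                              ≡⟨ unionUpTo-suc R (suc m) ⟩
    unionUpTo R (suc m) ++ R (suc m)                                       ≡⟨ cong₂ _++_ (unionUpTo-rebalance-≤ (<⇒≤ 1+m≤k)) (rebalance-≤ 1+m≤k) ⟩
    take (2 ^ suc m ∸ 1) M ++ take (2 ^ suc m) (drop (2 ^ suc m ∸ 1) M)    ≡⟨ take++take-drop (2 ^ suc m ∸ 1) (2 ^ suc m) M ⟩
    take ((2 ^ suc m ∸ 1) + 2 ^ suc m) M                                   ≡⟨ cong (λ r → take r M) (2^n∸1+2^n≡2^[1+n]∸1 (suc m)) ⟩
    take (2 ^ suc (suc m) ∸ 1) M                                           ∎
    where open ≡-Reasoning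

  unionUpTo-rebalance-suc : unionUpTo R (suc (suc k)) ≡ M
  unionUpTo-rebalance-suc = begin
    unionUpTo R (suc (suc k))                           ≡⟨ unionUpTo-suc R (suc k) ⟩
    unionUpTo R (suc k) ++ R (suc k)                    ≡⟨ cong₂ _++_ (unionUpTo-rebalance-≤ ≤-refl) rebalance-suc ⟩
    take (2 ^ suc k ∸ 1) M ++ drop (2 ^ suc k ∸ 1) M    ≡⟨ take++drop≡id (2 ^ suc k ∸ 1) M ⟩
    M                                                   ∎
    where open ≡-Reasoning

  ∈-rebalance⁻ : ∀ {x} i → x ∈ R i → ∃[ j ] x ∈ f j
  ∈-rebalance⁻ {x} i x∈ with i ≤? suc k
  ... | yes i≤1+k = let x∈M = subst (x ∈_) unionUpTo-rebalance-suc (∈-unionUpTo⁺ R i (s≤s i≤1+k) x∈)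
                        (j , _ , x∈fj) = ∈-unionUpTo⁻ f (suc (suc k)) (∈-sortDedup⁻ _ x∈M)
                    in j , x∈fj
  ... | no i≰1+k = i , subst (x ∈_) (rebalance-> (≰⇒> i≰1+k)) x∈

  ∈-rebalance⁺ : ∀ {x j m} → j ≤ m → k < m → x ∈ f j → x ∈ unionUpTo R (suc m)
  ∈-rebalance⁺ {x} {j} j≤m k<m x∈ with j ≤? suc k
  ... | yes j≤1+k = let x∈M = ∈-sortDedup⁺ (∈-unionUpTo⁺ f j (s≤s j≤1+k) x∈)
                        (i , i<2+k , x∈Ri) = ∈-unionUpTo⁻ R (suc (suc k)) (subst (x ∈_) (sym unionUpTo-rebalance-suc) x∈M)
                    in ∈-unionUpTo⁺ R i (≤-trans i<2+k (s≤s k<m)) x∈Ri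
  ... | no j≰1+k = ∈-unionUpTo⁺ R j (s≤s j≤m) (subst (x ∈_) (sym (rebalance-> (≰⇒> j≰1+k))) x∈)

  length-unionUpTo-rebalance : ∀ {m} → k < m → length (unionUpTo R (suc m)) ≤ length (unionUpTo f (suc m))
  length-unionUpTo-rebalance {suc m} k<1+m with m ≟ k
  ... | yes refl = subst (λ A → length A ≤ length (unionUpTo f (suc (suc k)))) (sym unionUpTo-rebalance-suc)
                         (length-sortDedup (unionUpTo f (suc (suc k))))
  ... | no m≢k = begin
    length (unionUpTo R (suc (suc m)))                    ≡⟨ length-unionUpTo-suc R (suc m) ⟩
    length (unionUpTo R (suc m)) + length (R (suc m))     ≤⟨ +-monoˡ-≤ _ (length-unionUpTo-rebalance k<m) ⟩
    length (unionUpTo f (suc m)) + length (R (suc m))     ≡⟨ cong (λ A → _ + length A) (rebalance-> (s≤s k<m)) ⟩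
    length (unionUpTo f (suc m)) + length (f (suc m))     ≡⟨ length-unionUpTo-suc f (suc m) ⟨
    length (unionUpTo f (suc (suc m)))                    ∎
    where
    open ≤-Reasoning
    k<m = ≤∧≢⇒< (s≤s⁻¹ k<1+m) (m≢k ∘ sym)

  ∈-rebalance-above : ∀ {m i y} → m ≤ k → m < i → y ∈ R i →
    y ∈ drop (2 ^ suc m ∸ 1) M ⊎ ∃[ j ] suc k < j × y ∈ f j
  ∈-rebalance-above {m} {i} {y} m≤k m<i y∈ with i ≤? k | i ≟ suc k
  ... | yes i≤k | _ = inj₁ (∈-drop-anti M (∸-monoˡ-≤ 1 (^-monoʳ-≤ 2 m<i))
                             (Sublist.lookup (take-⊆ (2 ^ i) _) (subst (y ∈_) (rebalance-≤ i≤k) y∈)))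
  ... | no _ | yes refl = inj₁ (∈-drop-anti M (∸-monoˡ-≤ 1 (^-monoʳ-≤ 2 (s≤s m≤k))) (subst (y ∈_) rebalance-suc y∈))
  ... | no i≰k | no i≢1+k = inj₂ (i , 1+k<i , subst (y ∈_) (rebalance-> 1+k<i) y∈)
    where 1+k<i = ≤∧≢⇒< (≰⇒> i≰k) (i≢1+k ∘ sym)

module _ (n : ℕ) {f : ℕ → List ℕ} {E : List ℕ} (I : Invariant (suc ∘ (n %2^_)) f E) where
  open Invariant I
  private
    t = suc n
    k = kk t
    U = unionUpTo f (suc (suc k))
    M = merged t f
    R = rebalance t f

  prefix-younger : ∀ {m y} → m ≤ k → y ∈ drop (2 ^ suc m ∸ 1) M ⊎ ∃[ j ] suc k < j × y ∈ f j →
    2 ^ suc m ∸ 1 ≤ length M × (∀ {x} → x ∈ take (2 ^ suc m ∸ 1) M → x < y)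
  prefix-younger {m} _ (inj₁ y∈) = <⇒≤ (∈-drop⇒<length r M y∈) , λ x∈ → take<drop r (sortDedup-strict U) x∈ y∈
    where r = 2 ^ suc m ∸ 1
  prefix-younger {m} {y} m≤k (inj₂ (j , 1+k<j , y∈fj)) with rank-bound (suc k) j 1+k<j y∈fj
  ... | W , bound = ≤-trans r≤W (Unique⇒length≤ (distinct W) (∈-sortDedup⁺ ∘ ⊆A W)) , x<y
    where
    r = 2 ^ suc m ∸ 1
    slack≡2^k : suc (n %2^ suc k) ≡ 2 ^ k
    slack≡2^k = trans (sym (%2^-suc n (suc k) ≤-refl)) (%2^-suc-kk n)
    r≤W : r ≤ size W
    r≤W = ≤-trans (∸-monoˡ-≤ 1 (^-monoʳ-≤ 2 (s≤s m≤k)))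
            (2^[2+k]≤1+s+2^k⇒2^[1+k]∸1≤s k (size W) (subst (λ s → 2 ^ suc (suc k) ≤ suc (size W + s)) slack≡2^k bound))
    x<y : ∀ {x} → x ∈ take r M → x < y
    x<y {x} x∈ with x <? y
    ... | yes x<y = x<y
    ... | no x≮y  = ⊥-elim (<⇒≱ (Younger-size<youngest x∈ (Younger-≤ (≮⇒≥ x≮y) W)) r≤W)

  Invariant-rebalance : Invariant (t %2^_) R E
  Invariant-rebalance = record
    { cover⁺ = cover⁺′ ; cover⁻ = cover⁻′ ; size-bound = size-bound′ ; rank-bound = rank-bound′ }
    where
    cover⁺′ : ∀ {x} → x ∈ E → ∃[ i ] x ∈ R i
    cover⁺′ x∈ = let (j , x∈fj) = cover⁺ x∈
                     (i , _ , x∈Ri) = ∈-unionUpTo⁻ R (suc (j ⊔ suc k)) (∈-rebalance⁺ t f (m≤m⊔n j (suc k)) (m≤n⊔m j (suc k)) x∈fj)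
                 in i , x∈Ri
    cover⁻′ : ∀ {x} i → x ∈ R i → x ∈ E
    cover⁻′ i x∈ = let (j , x∈fj) = ∈-rebalance⁻ t f i x∈ in cover⁻ j x∈fj
    size-bound′ : ∀ m → suc (length (unionUpTo R (suc m))) ≤ 2 ^ suc m + t %2^ m
    size-bound′ m with m ≤? k
    ... | yes m≤k = begin
      suc (length (unionUpTo R (suc m)))       ≡⟨ cong (suc ∘ length) (unionUpTo-rebalance-≤ t f m≤k) ⟩
      suc (length (take (2 ^ suc m ∸ 1) M))    ≤⟨ s≤s (≤-trans (≤-reflexive (length-take _ M)) (m⊓n≤m _ _)) ⟩
      suc (2 ^ suc m ∸ 1)                      ≡⟨ suc-pred (2 ^ suc m) {{m^n≢0 2 (suc m)}} ⟩
      2 ^ suc m                                ≤⟨ m≤m+n (2 ^ suc m) _ ⟩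
      2 ^ suc m + t %2^ m                      ∎
      where open ≤-Reasoning
    ... | no m≰k = begin
      suc (length (unionUpTo R (suc m)))       ≤⟨ s≤s (length-unionUpTo-rebalance t f (≰⇒> m≰k)) ⟩
      suc (length (unionUpTo f (suc m)))       ≤⟨ size-bound m ⟩
      2 ^ suc m + suc (n %2^ m)                ≡⟨ cong (2 ^ suc m +_) (%2^-suc n m (≰⇒> m≰k)) ⟨
      2 ^ suc m + t %2^ m                      ∎
      where open ≤-Reasoning
    rank-bound′ : ∀ m {y} i → m < i → y ∈ R i →
                  Σ[ W ∈ Younger y (unionUpTo R (suc m)) ] 2 ^ suc m ≤ suc (size W + t %2^ m)
    rank-bound′ m {y} i m<i y∈ with m ≤? k
    ... | yes m≤k with prefix-younger m≤k (∈-rebalance-above t f m≤k m<i y∈)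
    ...   | r≤M , all<y with take-Younger (2 ^ suc m ∸ 1) (sortDedup-unique U) r≤M all<y
    ...     | W , W≡r = Younger-⊆ (subst (_ ∈_) (sym (unionUpTo-rebalance-≤ t f m≤k))) W ,
                        subst₂ (λ s c → 2 ^ suc m ≤ suc (s + c)) (sym W≡r) (sym (%2^≡0 n m m≤k))
                               (≤-reflexive (trans (sym (suc-pred (2 ^ suc m) {{m^n≢0 2 (suc m)}})) (cong suc (sym (+-identityʳ _)))))
    rank-bound′ m {y} i m<i y∈ | no m≰k with rank-bound m i m<i (subst (y ∈_) (rebalance-> t f (≤-trans (s≤s (≰⇒> m≰k)) m<i)) y∈)
    ... | W , bound = Younger-⊆ f⊆R W , subst (λ c → 2 ^ suc m ≤ suc (size W + c)) (sym (%2^-suc n m k<m)) bound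
      where
      k<m = ≰⇒> m≰k
      f⊆R : unionUpTo f (suc m) ⊆ unionUpTo R (suc m)
      f⊆R x∈ = let (j , j<1+m , x∈fj) = ∈-unionUpTo⁻ f (suc m) x∈ in ∈-rebalance⁺ t f (s≤s⁻¹ j<1+m) k<m x∈fj

DeletesYoungest : List ℕ → Update → Set
DeletesYoungest E (ins _) = ⊤
DeletesYoungest E (del e) = ∀ x → x ∈ E → e ≤ x

Invariant-update : ∀ {n B E f} u → Invariant (n %2^_) B E → DeletesYoungest E u →
  f 0 ≡ updB0 u (B 0) → (∀ i → f (suc i) ≡ B (suc i)) → Invariant (suc ∘ (n %2^_)) f (applyE u E)
Invariant-update     (ins e) I _     f₀≡ f-suc = Invariant-ins I f-suc e f₀≡
Invariant-update {n} (del e) I e-min f₀≡ f-suc = Invariant-del I f-suc e (n%1≡0 n) e-min f₀≡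

Invariant-step : ∀ n u s → Invariant (n %2^_) (buckets s) (elems s) → DeletesYoungest (elems s) u →
  Invariant (suc n %2^_) (buckets (step (suc n) u s)) (elems (step (suc n) u s))
Invariant-step n u s I deletes-youngest with step-buckets (suc n) u s
... | f , f₀≡ , f-suc , B≡ = subst (λ B → Invariant (suc n %2^_) B (applyE u (elems s))) (sym B≡)
                               (Invariant-rebalance n (Invariant-update u I deletes-youngest f₀≡ f-suc))

Invariant-run : ∀ n s us → Invariant (n %2^_) (buckets s) (elems s) → Valid (elems s) us →
  Invariant ((n + length us) %2^_) (buckets (run (suc n) s us)) (elems (run (suc n) s us))
Invariant-run n s [] I _ = subst (λ t → Invariant (t %2^_) (buckets s) (elems s)) (sym (+-identityʳ n)) I
Invariant-run n s (u ∷ us) I valid = subst (λ t → Invariant (t %2^_) (buckets s′) (elems s′)) (sym (+-suc n (length us)))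
  (Invariant-run (suc n) (step (suc n) u s) us (Invariant-step n u s I (proj₁ (split u valid))) (proj₂ (split u valid)))
  where
  s′ = run (suc (suc n)) (step (suc n) u s) us
  split : ∀ u → Valid (elems s) (u ∷ us) → DeletesYoungest (elems s) u × Valid (applyE u (elems s)) us
  split (ins _) (_ , valid′)         = tt , valid′
  split (del _) (_ , e-min , valid′) = e-min , valid′

Invariant-init : Invariant (0 %2^_) (buckets initState) (elems initState)
Invariant-init = record
  { cover⁺     = λ ()
  ; cover⁻     = λ _ ()
  ; size-bound = λ m → subst (λ A → suc (length A) ≤ 2 ^ suc m + 0 %2^ m) (sym (unionUpTo-[] (suc m)))
                                (≤-trans (m^n>0 2 (suc m)) (m≤m+n (2 ^ suc m) (0 %2^ m)))
  ; rank-bound = λ _ _ _ ()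
  }

Valid-take : ∀ E us t → Valid E us → Valid E (take t us)
Valid-take E us             zero    _                   = tt
Valid-take E []             (suc t) _                   = tt
Valid-take E (ins e ∷ us)   (suc t) (e∉ , valid)        = e∉ , Valid-take (e ∷ E) us t valid
Valid-take E (del e ∷ us)   (suc t) (e∈ , e-min , valid) = e∈ , e-min , Valid-take _ us t valid

youngest⊆unionUpTo : ∀ {c B E i x} → Invariant c B E → c i ≡ 0 →
  x ∈ youngest (2 ^ suc i ∸ 1) E → x ∈ unionUpTo B (suc i)
youngest⊆unionUpTo {B = B} {E} {i} {x} I cᵢ≡0 x∈ with Invariant.cover⁺ I (∈-sortDedup⁻ E (Sublist.lookup (take-⊆ _ _) x∈))
... | j , x∈Bj with j ≤? i
...   | yes j≤i = ∈-unionUpTo⁺ B j (s≤s j≤i) x∈Bj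
...   | no j≰i with Invariant.rank-bound I i j (≰⇒> j≰i) x∈Bj
...     | W , bound = ⊥-elim (<⇒≱ (Younger-size<youngest x∈ (Younger-⊆ union⊆E W)) r≤W)
  where
  union⊆E : unionUpTo B (suc i) ⊆ E
  union⊆E z∈ = let (l , _ , z∈Bl) = ∈-unionUpTo⁻ B (suc i) z∈ in Invariant.cover⁻ I l z∈Bl
  r≤W : 2 ^ suc i ∸ 1 ≤ size W
  r≤W = ∸-monoˡ-≤ 1 (subst (λ s → 2 ^ suc i ≤ suc s) (trans (cong (size W +_) cᵢ≡0) (+-identityʳ _)) bound)

lemma2p1 : (us : List Update) → Valid [] us → (t : ℕ) → 1 ≤ t → t ≤ length us →
    (length (deduplicate _≟_ (unionUpTo (buckets (stateAt us t)) (suc (suc (kk t)))))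
        ≤ 2 ^ (kk t + 2) + 2 ^ kk t)
    × ((i : ℕ) → i ≤ kk t → (x : ℕ) →
        x ∈ youngest (2 ^ (suc i) ∸ 1) (elems (stateAt us t)) →
        x ∈ unionUpTo (buckets (stateAt us t)) (suc i))
lemma2p1 us valid t@(suc n) _ t≤|us| = size-bound′ , λ i i≤k x → youngest⊆unionUpTo {i = i} {x} I (%2^≡0 n i i≤k)
  where
  k = kk t
  B = buckets (stateAt us t)
  I : Invariant (t %2^_) B (elems (stateAt us t))
  I = subst (λ l → Invariant (l %2^_) B (elems (stateAt us t))) (trans (length-take t us) (m≤n⇒m⊓n≡m t≤|us|))
        (Invariant-run 0 initState (take t us) Invariant-init (Valid-take [] us t valid))
  size-bound′ : length (deduplicate _≟_ (unionUpTo B (suc (suc k)))) ≤ 2 ^ (k + 2) + 2 ^ k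
  size-bound′ = begin
    length (deduplicate _≟_ (unionUpTo B (suc (suc k))))   ≤⟨ length-deduplicate _≟_ (unionUpTo B (suc (suc k))) ⟩
    length (unionUpTo B (suc (suc k)))                     <⟨ Invariant.size-bound I (suc k) ⟩
    2 ^ suc (suc k) + t %2^ suc k                          ≡⟨ cong₂ (λ e c → 2 ^ e + c) (+-comm 2 k) (%2^-suc-kk n) ⟩
    2 ^ (k + 2) + 2 ^ k                                    ∎
    where open ≤-Reasoning
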